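{- Let $\equiv$ be a lattice congruence of the weak order on $S_n$ and let $\pi=a_1\cdots a_n\in S_n$. Suppose that for some $i<j$ we have $\{a_{i+1},\ldots,a_{j-1}\}\cap\,]m,M[\,=\emptyset$, where $m=\min\{a_i,a_j\}$ and $M=\max\{a_i,a_j\}$, and that there exists a permutation $\pi'\equiv\pi$ in which $a_j$ appears to the left of $a_i$. Then $f(m,M,L)\in\mathcal{F}_{\equiv}$, where $L=\{a_1,\ldots,a_{i-1}\}\cap\,]m,M[$.
   Context: $S_n$ is ordered by the weak order (inclusion of inversion sets), a lattice whose covers are transpositions of two adjacent entries; permutations are written as words $a_1\cdots a_n$. $]a,b[$ denotes $\{c\in\mathbb{N}: a<c<b\}$. For $a<b$ in $[n]$ and $L\subseteq\,]a,b[$, the fence $f(a,b,L)$ is the set of pairs $\{\pi_1,\pi_2\}$ of permutations such that $\pi_2$ is obtained from $\pi_1$ by swapping adjacent entries $a$ and $b$, and all elements of $L$ appear to the left, and all elements of $]a,b[\setminus L$ to the right, of $a,b$ in $\pi_1$ (and $\pi_2$). The forcing order on fences is: $f(a',b',L')\preceq f(a,b,L)$ iff $a'\leq a<b\leq b'$ and $L'\cap\,]a,b[\,=L$. For a lattice congruence $\equiv$ of the weak order (join- and meet-preserving equivalence), $\mathcal{F}_{\equiv}$ denotes the set of fences such that an adjacent-transposition edge joins two $\equiv$-equivalent permutations iff it belongs to a fence of $\mathcal{F}_{\equiv}$ (by a theorem of Reading such a set exists, is unique, and is a downset of the forcing order). -}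

module Defs where

open import Level using (0ℓ; suc)
open import Data.Nat using (ℕ; _≤ᵇ_)
open import Data.Bool using (if_then_else_)
open import Data.Fin using (Fin; toℕ; _<_)
open import Data.Fin.Subset using (Subset; _∈_; _∉_)
open import Data.Vec using (Vec; lookup)
open import Data.Vec.Relation.Unary.Unique.Propositional using (Unique)
open import Data.Product using (Σ; ∃; ∃-syntax; _×_)
open import Data.Sum using (_⊎_)
open import Relation.Binary.PropositionalEquality using (_≡_; _≢_)
open import Relation.Binary.Definitions using ()
open import Relation.Binary.Structures using (IsEquivalence)
open import Function.Bundles using (_⇔_)

-- Values and positions are both 0-indexed: [n] is modelled by Fin n.
-- A permutation a₁⋯aₙ is its word: a vector of n pairwise distinct values.
Perm : ℕ → Set
Perm n = Σ (Vec (Fin n) n) Unique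

module _ {n : ℕ} where

  at : Perm n → Fin n → Fin n
  at π k = lookup (Data.Product.proj₁ π) k

  LeftOf : Perm n → Fin n → Fin n → Set
  LeftOf π x y = ∃[ i ] ∃[ j ] (i < j × at π i ≡ x × at π j ≡ y)

  -- weak order: inclusion of inversion sets
  -- (an inversion of π is a pair of values a < b with b left of a)
  _≤w_ : Perm n → Perm n → Set
  π ≤w σ = ∀ (a b : Fin n) → a < b → LeftOf π b a → LeftOf σ b a

  IsJoin : Perm n → Perm n → Perm n → Set
  IsJoin x y j = x ≤w j × y ≤w j × (∀ z → x ≤w z → y ≤w z → j ≤w z)

  IsMeet : Perm n → Perm n → Perm n → Set
  IsMeet x y m = m ≤w x × m ≤w y × (∀ z → z ≤w x → z ≤w y → z ≤w m)

  record IsLatticeCongruence (R : Perm n → Perm n → Set) : Set where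
    field
      isEquivalence : IsEquivalence R
      join-compat : ∀ x x' y j j' → R x x' → IsJoin x y j → IsJoin x' y j' → R j j'
      meet-compat : ∀ x x' y m m' → R x x' → IsMeet x y m → IsMeet x' y m' → R m m'

  AdjSwap : Perm n → Perm n → Fin n → Fin n → Set
  AdjSwap π₁ π₂ x y =
    ∃[ k ] ∃[ k' ] (toℕ k' ≡ Data.Nat.suc (toℕ k)
      × at π₁ k ≡ x × at π₁ k' ≡ y × at π₂ k ≡ y × at π₂ k' ≡ x
      × (∀ p → p ≢ k → p ≢ k' → at π₁ p ≡ at π₂ p))

  Edge : Perm n → Perm n → Set
  Edge π₁ π₂ = ∃[ x ] ∃[ y ] AdjSwap π₁ π₂ x y

  Between : Fin n → Fin n → Fin n → Set
  Between a b c = a < c × c < b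

  InFence : Fin n → Fin n → Subset n → Perm n → Perm n → Set
  InFence a b L π₁ π₂ =
    a < b
    × (∀ c → c ∈ L → Between a b c)
    × (AdjSwap π₁ π₂ a b ⊎ AdjSwap π₁ π₂ b a)
    × (∀ c → Between a b c →
         (c ∈ L → LeftOf π₁ c a × LeftOf π₁ c b)
         × (c ∉ L → LeftOf π₁ a c × LeftOf π₁ b c))

  IsFenceSetOf : (Perm n → Perm n → Set) → (Fin n → Fin n → Subset n → Set) → Set
  IsFenceSetOf R F =
    ∀ π₁ π₂ → Edge π₁ π₂ →
      (R π₁ π₂ ⇔ (∃[ a ] ∃[ b ] ∃[ L ] (F a b L × InFence a b L π₁ π₂)))

minF : {n : ℕ} → Fin n → Fin n → Fin n
minF x y = if toℕ x ≤ᵇ toℕ y then x else y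

maxF : {n : ℕ} → Fin n → Fin n → Fin n
maxF x y = if toℕ x ≤ᵇ toℕ y then y else x

-- Write p = a_i and q = a_j and suppose p < q; when q < p, rank the values in reverse instead,
-- which turns the weak order upside down and so keeps ≡ a lattice congruence.
-- Let ρ be π with the entries strictly between positions i and j regrouped: those below p just
-- before p, the others (above q by hypothesis) just after q; let ρ′ be ρ with p, q swapped.
-- Then ρ ≤ π and ρ = π ∧ ρ′, while ρ′ = τ ∧ ρ′ for τ = π ∨ π′, and τ ≡ π ∨ π = π.  Hence ρ ≡ ρ′,
-- so the edge {ρ, ρ′} lies in a fence f(m, M, L′) of 𝓕≡, and L′ consists of the c ∈ ]m,M[
-- left of p in ρ, which are exactly those left of position i in π.
-- Joins are computed as transitive closures of unions of inversion sets.
module Submission where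

open import Level using (0ℓ)
open import Data.Nat as ℕ using (ℕ; zero; suc; z≤n; s≤s)
import Data.Nat.Properties as ℕₚ
open import Data.Fin as Fin using (Fin; toℕ; _<_)
import Data.Fin.Properties as Finₚ
open import Data.Product using (∃; ∃-syntax; _×_; _,_; proj₁; proj₂)
open import Data.Bool using (true; false)
open import Data.Sum using (_⊎_; inj₁; inj₂; [_,_]; [_,_]′; map₁; map₂)
open import Function using (_∘_; id)
open import Relation.Nullary using (¬_; Dec; yes; no; contradiction)
open import Relation.Nullary.Decidable using (_×-dec_; _⊎-dec_; ¬?; map′)
open import Induction.WellFounded using (Acc; acc)
open import Data.Nat.Induction using (<-wellFounded)
open import Relation.Unary using (Pred; _⊆_; Decidable)
open import Relation.Binary.PropositionalEquality using (_≡_; _≢_; refl; sym; trans; cong; subst; subst₂; module ≡-Reasoning)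
open import Relation.Binary.Definitions using (tri<; tri≈; tri>)
open import Function.Definitions using (Injective)
open import Function.Bundles using (_⇔_; mk⇔; Equivalence)
open Equivalence using (to; from)
open import Data.Vec using (tabulate)
open import Data.Vec.Properties using (lookup∘tabulate)
open import Data.Vec.Relation.Unary.Unique.Propositional.Properties using (lookup-injective; tabulate⁺)
open import Relation.Binary.Construct.Closure.Transitive using (TransClosure; _∷_; _++_) renaming ([_] to [_]⁺)
open import Data.Fin.Subset using (Subset; _∈_)
open import Data.Fin.Subset.Properties using (_∈?_; ⊆-antisym)
open import Relation.Binary.Structures using (IsEquivalence)
open import Defs

private variable n : ℕ

count : {P : Pred (Fin n) 0ℓ} → Decidable P → ℕ
count {zero}  P? = 0
count {suc n} P? with P? Fin.zero
... | yes _ = suc (count (P? ∘ Fin.suc))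
... | no _  = count (P? ∘ Fin.suc)

count-mono : ∀ {n} {P Q : Pred (Fin n) 0ℓ} (P? : Decidable P) (Q? : Decidable Q) → P ⊆ Q → count P? ℕ.≤ count Q?
count-mono {n = zero}  P? Q? P⊆Q = z≤n
count-mono {n = suc n} P? Q? P⊆Q with P? Fin.zero | Q? Fin.zero
... | yes p | yes _ = s≤s (count-mono (P? ∘ Fin.suc) (Q? ∘ Fin.suc) P⊆Q)
... | yes p | no ¬q = contradiction (P⊆Q p) ¬q
... | no _  | yes _ = ℕₚ.m≤n⇒m≤1+n (count-mono (P? ∘ Fin.suc) (Q? ∘ Fin.suc) P⊆Q)
... | no _  | no _  = count-mono (P? ∘ Fin.suc) (Q? ∘ Fin.suc) P⊆Q

count-cong : ∀ {n} {P Q : Pred (Fin n) 0ℓ} (P? : Decidable P) (Q? : Decidable Q) → P ⊆ Q → Q ⊆ P → count P? ≡ count Q?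
count-cong P? Q? P⊆Q Q⊆P = ℕₚ.≤-antisym (count-mono P? Q? P⊆Q) (count-mono Q? P? Q⊆P)

count-< : ∀ {n} {P Q : Pred (Fin n) 0ℓ} (P? : Decidable P) (Q? : Decidable Q) → P ⊆ Q → ∀ w → Q w → ¬ P w → count P? ℕ.< count Q?
count-< {n = suc n} P? Q? P⊆Q Fin.zero qw ¬pw with P? Fin.zero | Q? Fin.zero
... | yes pw | _     = contradiction pw ¬pw
... | no _   | yes _ = s≤s (count-mono (P? ∘ Fin.suc) (Q? ∘ Fin.suc) P⊆Q)
... | no _   | no ¬q = contradiction qw ¬q
count-< {n = suc n} P? Q? P⊆Q (Fin.suc w) qw ¬pw with P? Fin.zero | Q? Fin.zero
... | yes p | yes _ = s≤s (count-< (P? ∘ Fin.suc) (Q? ∘ Fin.suc) P⊆Q w qw ¬pw)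
... | yes p | no ¬q = contradiction (P⊆Q p) ¬q
... | no _  | yes _ = ℕₚ.m≤n⇒m≤1+n (count-< (P? ∘ Fin.suc) (Q? ∘ Fin.suc) P⊆Q w qw ¬pw)
... | no _  | no _  = count-< (P? ∘ Fin.suc) (Q? ∘ Fin.suc) P⊆Q w qw ¬pw

count<n : ∀ {n} {P : Pred (Fin n) 0ℓ} (P? : Decidable P) → ∀ w → ¬ P w → count P? ℕ.< n
count<n {n = suc n} P? Fin.zero ¬pw with P? Fin.zero
... | yes pw = contradiction pw ¬pw
... | no _   = s≤s (count≤n (P? ∘ Fin.suc))
  where
  count≤n : ∀ {m} {P : Pred (Fin m) 0ℓ} (P? : Decidable P) → count P? ℕ.≤ m
  count≤n {zero}  P? = z≤n
  count≤n {suc m} P? with P? Fin.zero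
  ... | yes _ = s≤s (count≤n (P? ∘ Fin.suc))
  ... | no _  = ℕₚ.m≤n⇒m≤1+n (count≤n (P? ∘ Fin.suc))
count<n {n = suc n} P? (Fin.suc w) ¬pw with P? Fin.zero
... | yes _ = s≤s (count<n (P? ∘ Fin.suc) w ¬pw)
... | no _  = ℕₚ.m≤n⇒m≤1+n (count<n (P? ∘ Fin.suc) w ¬pw)

count-insert : ∀ {n} {P Q : Pred (Fin n) 0ℓ} (P? : Decidable P) (Q? : Decidable Q) → P ⊆ Q →
               ∀ w → (∀ x → Q x → P x ⊎ x ≡ w) → Q w → ¬ P w → count Q? ≡ suc (count P?)
count-insert {suc n} P? Q? P⊆Q Fin.zero Q⊆P+w qw ¬pw with P? Fin.zero | Q? Fin.zero
... | yes pw | _     = contradiction pw ¬pw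
... | no _   | no ¬q = contradiction qw ¬q
... | no _   | yes _ =
  cong suc (count-cong (Q? ∘ Fin.suc) (P? ∘ Fin.suc) (λ {x} q → [ id , (λ ()) ] (Q⊆P+w (Fin.suc x) q)) P⊆Q)
count-insert {suc n} P? Q? P⊆Q (Fin.suc w) Q⊆P+w qw ¬pw with P? Fin.zero | Q? Fin.zero | Q⊆P+w Fin.zero
... | yes p  | yes _ | _ = cong suc (count-insert (P? ∘ Fin.suc) (Q? ∘ Fin.suc) P⊆Q w
      (λ x q → map₂ Finₚ.suc-injective (Q⊆P+w (Fin.suc x) q)) qw ¬pw)
... | yes p  | no ¬q | _ = contradiction (P⊆Q p) ¬q
... | no ¬p  | yes q | Q⊆P+w₀ = contradiction ([ id , (λ ()) ] (Q⊆P+w₀ q)) ¬p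
... | no _   | no _  | _ = count-insert (P? ∘ Fin.suc) (Q? ∘ Fin.suc) P⊆Q w
      (λ x q → map₂ Finₚ.suc-injective (Q⊆P+w (Fin.suc x) q)) qw ¬pw

injective⇒surjective : (f : Fin n → Fin n) → Injective _≡_ _≡_ f → ∀ y → ∃ λ x → f x ≡ y
injective⇒surjective f f-inj y with Finₚ.any? (λ x → f x Finₚ.≟ y)
... | yes found = found
injective⇒surjective {suc n} f f-inj y | no ¬found =
  contradiction (Finₚ.injective⇒≤ punchOut∘f-injective) ℕₚ.1+n≰n
  where
  y≢f : ∀ x → y ≢ f x
  y≢f x y≡fx = ¬found (x , sym y≡fx)
  punchOut∘f-injective : Injective _≡_ _≡_ (λ x → Fin.punchOut (y≢f x))
  punchOut∘f-injective {a} {b} eq = f-inj (Finₚ.punchOut-injective (y≢f a) (y≢f b) eq)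

record TotalOrder (n : ℕ) : Set₁ where
  infix 4 _≺_ _≺?_
  field
    _≺_     : Fin n → Fin n → Set
    _≺?_    : ∀ x y → Dec (x ≺ y)
    ≺-irrefl : ∀ {x} → ¬ x ≺ x
    ≺-trans  : ∀ {x y z} → x ≺ y → y ≺ z → x ≺ z
    ≺-connex : ∀ {x y} → x ≢ y → x ≺ y ⊎ y ≺ x

  ≺-asym : ∀ {x y} → x ≺ y → ¬ y ≺ x
  ≺-asym x≺y y≺x = ≺-irrefl (≺-trans x≺y y≺x)

Realises : Perm n → TotalOrder n → Set
Realises π o = ∀ x y → LeftOf π x y ⇔ TotalOrder._≺_ o x y

module Positions (π : Perm n) where

  at-injective : Injective _≡_ _≡_ (at π)
  at-injective {k} {l} = lookup-injective (proj₂ π) k l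

  position : Fin n → Fin n
  position x = proj₁ (injective⇒surjective (at π) at-injective x)

  at-position : ∀ x → at π (position x) ≡ x
  at-position x = proj₂ (injective⇒surjective (at π) at-injective x)

  position-at : ∀ k → position (at π k) ≡ k
  position-at k = at-injective (at-position (at π k))

  position-injective : Injective _≡_ _≡_ position
  position-injective {x} {y} eq = trans (sym (at-position x)) (trans (cong (at π) eq) (at-position y))

  order : TotalOrder n
  order = record
    { _≺_      = λ x y → position x < position y
    ; _≺?_     = λ x y → position x Finₚ.<? position y
    ; ≺-irrefl = Finₚ.<-irrefl refl
    ; ≺-trans  = Finₚ.<-trans
    ; ≺-connex = connex
    }
    where
    connex : ∀ {x y} → x ≢ y → position x < position y ⊎ position y < position x
    connex {x} {y} x≢y with Finₚ.<-cmp (position x) (position y)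
    ... | tri< lt _ _ = inj₁ lt
    ... | tri≈ _ eq _ = contradiction (position-injective eq) x≢y
    ... | tri> _ _ gt = inj₂ gt

  realises : Realises π order
  realises x y = mk⇔ position-< (λ lt → position x , position y , lt , at-position x , at-position y)
    where
    position-< : LeftOf π x y → position x < position y
    position-< (k , l , k<l , refl , refl) = subst₂ _<_ (sym (position-at k)) (sym (position-at l)) k<l

  leftOf? : ∀ x y → Dec (LeftOf π x y)
  leftOf? x y = map′ (from (realises x y)) (to (realises x y)) (position x Finₚ.<? position y)

  leftOf-asym : ∀ {x y} → LeftOf π x y → ¬ LeftOf π y x
  leftOf-asym {x} {y} x◃y y◃x = TotalOrder.≺-asym order (to (realises x y) x◃y) (to (realises y x) y◃x)

  leftOf-connex : ∀ {x y} → x ≢ y → LeftOf π x y ⊎ LeftOf π y x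
  leftOf-connex {x} {y} x≢y = Data.Sum.map (from (realises x y)) (from (realises y x)) (TotalOrder.≺-connex order x≢y)

  lexOrder : (Fin n → ℕ) → TotalOrder n
  lexOrder key = record
    { _≺_      = _⊏_
    ; _≺?_     = λ u v → (key u ℕₚ.<? key v) ⊎-dec ((key u ℕₚ.≟ key v) ×-dec (position u Finₚ.<? position v))
    ; ≺-irrefl = [ ℕₚ.<-irrefl refl , Finₚ.<-irrefl refl ∘ proj₂ ]
    ; ≺-trans  = ⊏-trans
    ; ≺-connex = ⊏-connex
    }
    where
    _⊏_ : Fin n → Fin n → Set
    u ⊏ v = key u ℕ.< key v ⊎ (key u ≡ key v × position u < position v)
    ⊏-trans : ∀ {u v w} → u ⊏ v → v ⊏ w → u ⊏ w
    ⊏-trans (inj₁ u<v)         (inj₁ v<w)         = inj₁ (ℕₚ.<-trans u<v v<w)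
    ⊏-trans {u} (inj₁ u<v)       (inj₂ (v≡w , _))   = inj₁ (subst (key u ℕ.<_) v≡w u<v)
    ⊏-trans {w = w} (inj₂ (u≡v , _)) (inj₁ v<w)     = inj₁ (subst (ℕ._< key w) (sym u≡v) v<w)
    ⊏-trans (inj₂ (u≡v , u<v)) (inj₂ (v≡w , v<w)) = inj₂ (trans u≡v v≡w , Finₚ.<-trans u<v v<w)
    ⊏-connex : ∀ {u v} → u ≢ v → u ⊏ v ⊎ v ⊏ u
    ⊏-connex {u} {v} u≢v with ℕₚ.<-cmp (key u) (key v) | TotalOrder.≺-connex order u≢v
    ... | tri< u<v _ _ | _             = inj₁ (inj₁ u<v)
    ... | tri> _ _ v<u | _             = inj₂ (inj₁ v<u)
    ... | tri≈ _ u≡v _ | inj₁ u<v      = inj₁ (inj₂ (u≡v , u<v))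
    ... | tri≈ _ u≡v _ | inj₂ v<u      = inj₂ (inj₂ (sym u≡v , v<u))

  lex-key< : ∀ key {u v} → (key u ≡ key v → u ≡ v) → TotalOrder._≺_ (lexOrder key) u v → key u ℕ.< key v
  lex-key< key same (inj₁ u<v)         = u<v
  lex-key< key same (inj₂ (u≡v , u<v)) = contradiction (cong position (same u≡v)) (Finₚ.<⇒≢ u<v)

open Positions public using (leftOf?; leftOf-asym; leftOf-connex)

module Realisation (o : TotalOrder n) where
  open TotalOrder o
  open ≡-Reasoning

  rank : Fin n → ℕ
  rank x = count (_≺? x)

  rank-mono : ∀ {x y} → x ≺ y → rank x ℕ.< rank y
  rank-mono {x} {y} x≺y = count-< (_≺? x) (_≺? y) (λ u≺x → ≺-trans u≺x x≺y) x x≺y ≺-irrefl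

  rank<n : ∀ x → rank x ℕ.< n
  rank<n x = count<n (_≺? x) x ≺-irrefl

  rank-reflects : ∀ {x y} → rank x ℕ.< rank y → x ≺ y
  rank-reflects {x} {y} lt with x Finₚ.≟ y
  ... | yes refl = contradiction lt (ℕₚ.<-irrefl refl)
  ... | no x≢y   = [ id , (λ y≺x → contradiction (rank-mono y≺x) (ℕₚ.<⇒≯ lt)) ] (≺-connex x≢y)

  slot : Fin n → Fin n
  slot x = Fin.fromℕ< (rank<n x)

  toℕ-slot : ∀ x → toℕ (slot x) ≡ rank x
  toℕ-slot x = Finₚ.toℕ-fromℕ< (rank<n x)

  rank-injective : Injective _≡_ _≡_ rank
  rank-injective {x} {y} eq with x Finₚ.≟ y
  ... | yes x≡y = x≡y
  ... | no x≢y  = contradiction eq ([ ℕₚ.<⇒≢ ∘ rank-mono , (λ y≺x → ℕₚ.<⇒≢ (rank-mono y≺x) ∘ sym) ]′ (≺-connex x≢y))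

  slot-injective : Injective _≡_ _≡_ slot
  slot-injective {x} {y} eq = rank-injective (trans (sym (toℕ-slot x)) (trans (cong toℕ eq) (toℕ-slot y)))

  occupant : Fin n → Fin n
  occupant k = proj₁ (injective⇒surjective slot slot-injective k)

  slot-occupant : ∀ k → slot (occupant k) ≡ k
  slot-occupant k = proj₂ (injective⇒surjective slot slot-injective k)

  perm : Perm n
  perm = tabulate occupant , tabulate⁺ (λ {k} {l} eq → trans (sym (slot-occupant k)) (trans (cong slot eq) (slot-occupant l)))

  rank-at : ∀ k → rank (at perm k) ≡ toℕ k
  rank-at k = begin
    rank (at perm k)           ≡⟨ cong rank (lookup∘tabulate occupant k) ⟩
    rank (occupant k)          ≡⟨ sym (toℕ-slot (occupant k)) ⟩
    toℕ (slot (occupant k))    ≡⟨ cong toℕ (slot-occupant k) ⟩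
    toℕ k                      ∎

  slot-at : ∀ k → slot (at perm k) ≡ k
  slot-at k = Finₚ.toℕ-injective (trans (toℕ-slot (at perm k)) (rank-at k))

  at-slot : ∀ k x → toℕ k ≡ rank x → at perm k ≡ x
  at-slot k x k≡rank = rank-injective (trans (rank-at k) k≡rank)

  realises : Realises perm o
  realises x y = mk⇔ reflects (λ x≺y → slot x , slot y , slot-< x≺y , at-slot _ x (toℕ-slot x) , at-slot _ y (toℕ-slot y))
    where
    slot-< : x ≺ y → slot x < slot y
    slot-< x≺y = subst₂ ℕ._<_ (sym (toℕ-slot x)) (sym (toℕ-slot y)) (rank-mono x≺y)
    reflects : LeftOf perm x y → x ≺ y
    reflects (k , l , k<l , refl , refl) = rank-reflects (subst₂ ℕ._<_ (sym (rank-at k)) (sym (rank-at l)) k<l)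

Covers : TotalOrder n → Fin n → Fin n → Set
Covers o p q = p ≺ q × (∀ {v} → p ≺ v → ¬ v ≺ q)
  where open TotalOrder o

module SwapCover (o : TotalOrder n) {p q : Fin n} (p⋖q : Covers o p q) where
  open TotalOrder o

  p≢q : p ≢ q
  p≢q refl = ≺-irrefl (proj₁ p⋖q)

  below-q : ∀ {u} → u ≺ q → u ≢ p → u ≺ p
  below-q u≺q u≢p = [ id , (λ p≺u → contradiction u≺q (proj₂ p⋖q p≺u)) ] (≺-connex u≢p)

  above-p : ∀ {w} → p ≺ w → w ≢ q → q ≺ w
  above-p p≺w w≢q = [ (λ w≺q → contradiction w≺q (proj₂ p⋖q p≺w)) , id ] (≺-connex w≢q)

  below-q-or-p : ∀ {u} → u ≺ q → u ≺ p ⊎ u ≡ p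
  below-q-or-p {u} u≺q with u Finₚ.≟ p
  ... | yes u≡p = inj₂ u≡p
  ... | no u≢p  = inj₁ (below-q u≺q u≢p)

  _≺′_ : Fin n → Fin n → Set
  u ≺′ v = (u ≺ v × ¬ (u ≡ p × v ≡ q)) ⊎ (u ≡ q × v ≡ p)

  swapped : TotalOrder n
  swapped = record
    { _≺_      = _≺′_
    ; _≺?_     = λ u v → ((u ≺? v) ×-dec ¬? ((u Finₚ.≟ p) ×-dec (v Finₚ.≟ q))) ⊎-dec ((u Finₚ.≟ q) ×-dec (v Finₚ.≟ p))
    ; ≺-irrefl = [ ≺-irrefl ∘ proj₁ , (λ { (refl , q≡p) → p≢q (sym q≡p) }) ]
    ; ≺-trans  = ≺′-trans
    ; ≺-connex = ≺′-connex
    }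
    where
    ≺′-trans : ∀ {u v w} → u ≺′ v → v ≺′ w → u ≺′ w
    ≺′-trans (inj₁ (u≺v , _)) (inj₁ (v≺w , _)) =
      inj₁ (≺-trans u≺v v≺w , λ { (refl , refl) → proj₂ p⋖q u≺v v≺w })
    ≺′-trans (inj₁ (u≺q , ¬pq)) (inj₂ (refl , refl)) =
      inj₁ (below-q u≺q (λ u≡p → ¬pq (u≡p , refl)) , λ { (_ , p≡q) → p≢q p≡q })
    ≺′-trans (inj₂ (refl , refl)) (inj₁ (p≺w , ¬pq)) =
      inj₁ (above-p p≺w (λ w≡q → ¬pq (refl , w≡q)) , λ { (q≡p , _) → p≢q (sym q≡p) })
    ≺′-trans (inj₂ (refl , refl)) (inj₂ (p≡q , _)) = contradiction p≡q p≢q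
    ≺′-connex : ∀ {u v} → u ≢ v → u ≺′ v ⊎ v ≺′ u
    ≺′-connex {u} {v} u≢v with ≺-connex u≢v | u Finₚ.≟ p ×-dec v Finₚ.≟ q | v Finₚ.≟ p ×-dec u Finₚ.≟ q
    ... | inj₁ u≺v | yes (u≡p , v≡q) | _ = inj₂ (inj₂ (v≡q , u≡p))
    ... | inj₁ u≺v | no ¬pq          | _ = inj₁ (inj₁ (u≺v , ¬pq))
    ... | inj₂ v≺u | _ | yes (v≡p , u≡q) = inj₁ (inj₂ (u≡q , v≡p))
    ... | inj₂ v≺u | _ | no ¬pq          = inj₂ (inj₁ (v≺u , ¬pq))

  ≺′⇒≺ : ∀ {u v} → u ≺′ v → u ≺ v ⊎ (u ≡ q × v ≡ p)
  ≺′⇒≺ = map₁ proj₁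

  ≺⇒≺′ : ∀ {u v} → u ≺ v → u ≺′ v ⊎ (u ≡ p × v ≡ q)
  ≺⇒≺′ {u} {v} u≺v with u Finₚ.≟ p ×-dec v Finₚ.≟ q
  ... | yes pq = inj₂ pq
  ... | no ¬pq = inj₁ (inj₁ (u≺v , ¬pq))

  open TotalOrder swapped using () renaming (_≺?_ to _≺′?_)
  module O = Realisation o
  module O′ = Realisation swapped

  rank-q : O.rank q ≡ suc (O.rank p)
  rank-q = count-insert (_≺? p) (_≺? q) (λ u≺p → ≺-trans u≺p (proj₁ p⋖q)) p
    (λ _ → below-q-or-p)
    (proj₁ p⋖q) ≺-irrefl

  rank′-p : O′.rank p ≡ suc (O.rank p)
  rank′-p = count-insert (_≺? p) (_≺′? p) (λ u≺p → inj₁ (u≺p , p≢q ∘ proj₂)) q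
    (λ _ → Data.Sum.map proj₁ proj₁) (inj₂ (refl , refl)) (≺-asym (proj₁ p⋖q))

  rank′-q : O′.rank q ≡ O.rank p
  rank′-q = count-cong (_≺′? q) (_≺? p)
    [ (λ (u≺q , ¬pq) → below-q u≺q (λ u≡p → ¬pq (u≡p , refl))) , (λ (_ , q≡p) → contradiction (sym q≡p) p≢q) ]
    (λ u≺p → inj₁ (≺-trans u≺p (proj₁ p⋖q) , λ (u≡p , _) → ≺-irrefl (subst (_≺ p) u≡p u≺p)))

  rank′-other : ∀ {v} → v ≢ p → v ≢ q → O′.rank v ≡ O.rank v
  rank′-other {v} v≢p v≢q = count-cong (_≺′? v) (_≺? v)
    [ proj₁ , (λ (_ , v≡p) → contradiction v≡p v≢p) ]
    (λ u≺v → inj₁ (u≺v , λ (_ , v≡q) → v≢q v≡q))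

  adjacent : AdjSwap O.perm O′.perm p q
  adjacent = O.slot p , O.slot q , trans (O.toℕ-slot q) (trans rank-q (cong suc (sym (O.toℕ-slot p))))
           , O.at-slot _ p (O.toℕ-slot p) , O.at-slot _ q (O.toℕ-slot q)
           , O′.at-slot _ q (trans (O.toℕ-slot p) (sym rank′-q))
           , O′.at-slot _ p (trans (O.toℕ-slot q) (trans rank-q (sym rank′-p)))
           , unmoved
    where
    unmoved : ∀ t → t ≢ O.slot p → t ≢ O.slot q → at O.perm t ≡ at O′.perm t
    unmoved t t≢k t≢k′ = sym (O′.at-slot t (at O.perm t) (trans (sym (O.rank-at t)) (sym (rank′-other v≢p v≢q))))
      where
      v≢p : at O.perm t ≢ p
      v≢p v≡p = t≢k (trans (sym (O.slot-at t)) (cong O.slot v≡p))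
      v≢q : at O.perm t ≢ q
      v≢q v≡q = t≢k′ (trans (sym (O.slot-at t)) (cong O.slot v≡q))

infix 4 _≤[_]_
_≤[_]_ : Perm n → (Fin n → ℕ) → Perm n → Set
σ ≤[ r ] τ = ∀ a b → r a ℕ.< r b → LeftOf σ b a → LeftOf τ b a

IsJoinBy : (Fin n → ℕ) → Perm n → Perm n → Perm n → Set
IsJoinBy r x y j = x ≤[ r ] j × y ≤[ r ] j × (∀ z → x ≤[ r ] z → y ≤[ r ] z → j ≤[ r ] z)

IsMeetBy : (Fin n → ℕ) → Perm n → Perm n → Perm n → Set
IsMeetBy r x y m = m ≤[ r ] x × m ≤[ r ] y × (∀ z → z ≤[ r ] x → z ≤[ r ] y → z ≤[ r ] m)

module JoinOrder (r : Fin n → ℕ) (r-injective : Injective _≡_ _≡_ r) (X Y : TotalOrder n) where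
  open TotalOrder X using () renaming (_≺_ to _≺X_; _≺?_ to _≺X?_; ≺-trans to ≺X-trans; ≺-connex to ≺X-connex)
  open TotalOrder Y using () renaming (_≺_ to _≺Y_; _≺?_ to _≺Y?_; ≺-trans to ≺Y-trans; ≺-connex to ≺Y-connex)

  infix 4 _⇝_ _⇝⁺_ _≺J_

  _⇝_ : Fin n → Fin n → Set
  b ⇝ a = r a ℕ.< r b × (b ≺X a ⊎ b ≺Y a)

  _⇝⁺_ : Fin n → Fin n → Set
  _⇝⁺_ = TransClosure _⇝_

  ⇝-split : ∀ {w u v} → w ⇝ u → r u ℕ.< r v → r v ℕ.< r w → w ⇝ v ⊎ v ⇝ u
  ⇝-split (_ , inj₁ w≺u) u<v v<w with ≺X-connex (λ w≡v → ℕₚ.<-irrefl (cong r (sym w≡v)) v<w)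
  ... | inj₁ w≺v = inj₁ (v<w , inj₁ w≺v)
  ... | inj₂ v≺w = inj₂ (u<v , inj₁ (≺X-trans v≺w w≺u))
  ⇝-split (_ , inj₂ w≺u) u<v v<w with ≺Y-connex (λ w≡v → ℕₚ.<-irrefl (cong r (sym w≡v)) v<w)
  ... | inj₁ w≺v = inj₁ (v<w , inj₂ w≺v)
  ... | inj₂ v≺w = inj₂ (u<v , inj₂ (≺Y-trans v≺w w≺u))

  ⇝⁺-split : ∀ {w u v} → w ⇝⁺ u → r u ℕ.< r v → r v ℕ.< r w → w ⇝⁺ v ⊎ v ⇝⁺ u
  ⇝⁺-split [ w⇝u ]⁺ u<v v<w = Data.Sum.map [_]⁺ [_]⁺ (⇝-split w⇝u u<v v<w)
  ⇝⁺-split {v = v} (_∷_ {y = d} w⇝d d⇝⁺u) u<v v<w with ℕₚ.<-cmp (r v) (r d)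
  ... | tri≈ _ v≡d _ = inj₁ [ subst (_ ⇝_) (r-injective (sym v≡d)) w⇝d ]⁺
  ... | tri< v<d _ _ = map₁ (w⇝d ∷_) (⇝⁺-split d⇝⁺u u<v v<d)
  ... | tri> _ _ d<v = Data.Sum.map [_]⁺ (_∷ d⇝⁺u) (⇝-split w⇝d d<v v<w)

  _⇝?_ : ∀ b a → Dec (b ⇝ a)
  b ⇝? a = (r a ℕₚ.<? r b) ×-dec ((b ≺X? a) ⊎-dec (b ≺Y? a))

  ⇝⁺-dec : ∀ b → Acc ℕ._<_ (r b) → ∀ a → Dec (b ⇝⁺ a)
  ⇝⁺-dec b (acc rec) a = map′ prepend uncons (Finₚ.any? first-step)
    where
    first-step : ∀ d → Dec (b ⇝ d × (d ≡ a ⊎ d ⇝⁺ a))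
    first-step d with b ⇝? d
    ... | no ¬b⇝d = no (¬b⇝d ∘ proj₁)
    ... | yes b⇝d = map′ (b⇝d ,_) proj₂ ((d Finₚ.≟ a) ⊎-dec ⇝⁺-dec d (rec (proj₁ b⇝d)) a)
    prepend : ∃ (λ d → b ⇝ d × (d ≡ a ⊎ d ⇝⁺ a)) → b ⇝⁺ a
    prepend (_ , b⇝a , inj₁ refl) = [ b⇝a ]⁺
    prepend (_ , b⇝d , inj₂ d⇝⁺a) = b⇝d ∷ d⇝⁺a
    uncons : b ⇝⁺ a → ∃ (λ d → b ⇝ d × (d ≡ a ⊎ d ⇝⁺ a))
    uncons [ b⇝a ]⁺       = a , b⇝a , inj₁ refl
    uncons (b⇝d ∷ d⇝⁺a) = _ , b⇝d , inj₂ d⇝⁺a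

  _⇝⁺?_ : ∀ b a → Dec (b ⇝⁺ a)
  b ⇝⁺? a = ⇝⁺-dec b (<-wellFounded (r b)) a

  -- The inversions of the join are the transitive closure of those of X and Y;
  -- ⇝⁺-split shows that the complement of this closure is closed as well.
  _≺J_ : Fin n → Fin n → Set
  u ≺J v = (r u ℕ.< r v × ¬ v ⇝⁺ u) ⊎ (r v ℕ.< r u × u ⇝⁺ v)

  ≺J-trans : ∀ {u v w} → u ≺J v → v ≺J w → u ≺J w
  ≺J-trans (inj₁ (u<v , ¬v⇝⁺u)) (inj₁ (v<w , ¬w⇝⁺v)) =
    inj₁ (ℕₚ.<-trans u<v v<w , λ w⇝⁺u → [ ¬w⇝⁺v , ¬v⇝⁺u ] (⇝⁺-split w⇝⁺u u<v v<w))
  ≺J-trans {u} {v} {w} (inj₁ (u<v , ¬v⇝⁺u)) (inj₂ (w<v , v⇝⁺w)) with ℕₚ.<-cmp (r u) (r w)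
  ... | tri≈ _ u≡w _ = contradiction (subst (v ⇝⁺_) (r-injective (sym u≡w)) v⇝⁺w) ¬v⇝⁺u
  ... | tri< u<w _ _ = inj₁ (u<w , λ w⇝⁺u → ¬v⇝⁺u (v⇝⁺w ++ w⇝⁺u))
  ... | tri> _ _ w<u = inj₂ (w<u , [ (λ v⇝⁺u → contradiction v⇝⁺u ¬v⇝⁺u) , id ] (⇝⁺-split v⇝⁺w w<u u<v))
  ≺J-trans {u} {v} {w} (inj₂ (v<u , u⇝⁺v)) (inj₁ (v<w , ¬w⇝⁺v)) with ℕₚ.<-cmp (r u) (r w)
  ... | tri≈ _ u≡w _ = contradiction (subst (_⇝⁺ v) (r-injective u≡w) u⇝⁺v) ¬w⇝⁺v
  ... | tri< u<w _ _ = inj₁ (u<w , λ w⇝⁺u → ¬w⇝⁺v (w⇝⁺u ++ u⇝⁺v))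
  ... | tri> _ _ w<u = inj₂ (w<u , [ id , (λ w⇝⁺v → contradiction w⇝⁺v ¬w⇝⁺v) ] (⇝⁺-split u⇝⁺v v<w w<u))
  ≺J-trans (inj₂ (v<u , u⇝⁺v)) (inj₂ (w<v , v⇝⁺w)) = inj₂ (ℕₚ.<-trans w<v v<u , u⇝⁺v ++ v⇝⁺w)

  ≺J-connex : ∀ {u v} → u ≢ v → u ≺J v ⊎ v ≺J u
  ≺J-connex {u} {v} u≢v with ℕₚ.<-cmp (r u) (r v)
  ... | tri≈ _ eq _ = contradiction (r-injective eq) u≢v
  ... | tri< u<v _ _ with v ⇝⁺? u
  ...   | yes v⇝⁺u = inj₂ (inj₂ (u<v , v⇝⁺u))
  ...   | no ¬v⇝⁺u = inj₁ (inj₁ (u<v , ¬v⇝⁺u))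
  ≺J-connex {u} {v} u≢v | tri> _ _ v<u with u ⇝⁺? v
  ...   | yes u⇝⁺v = inj₁ (inj₂ (v<u , u⇝⁺v))
  ...   | no ¬u⇝⁺v = inj₂ (inj₁ (v<u , ¬u⇝⁺v))

  join : TotalOrder n
  join = record
    { _≺_      = _≺J_
    ; _≺?_     = λ u v → ((r u ℕₚ.<? r v) ×-dec ¬? (v ⇝⁺? u)) ⊎-dec ((r v ℕₚ.<? r u) ×-dec (u ⇝⁺? v))
    ; ≺-irrefl = [ ℕₚ.<-irrefl refl ∘ proj₁ , ℕₚ.<-irrefl refl ∘ proj₁ ]
    ; ≺-trans  = ≺J-trans
    ; ≺-connex = ≺J-connex
    }

  join-inverts-X : ∀ a b → r a ℕ.< r b → b ≺X a → b ≺J a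
  join-inverts-X a b a<b b≺a = inj₂ (a<b , [ a<b , inj₁ b≺a ]⁺)

  join-inverts-Y : ∀ a b → r a ℕ.< r b → b ≺Y a → b ≺J a
  join-inverts-Y a b a<b b≺a = inj₂ (a<b , [ a<b , inj₂ b≺a ]⁺)

  join-least : (Z : TotalOrder n) → let open TotalOrder Z in
               (∀ a b → r a ℕ.< r b → b ≺X a → b ≺ a) → (∀ a b → r a ℕ.< r b → b ≺Y a → b ≺ a) →
               ∀ a b → r a ℕ.< r b → b ≺J a → b ≺ a
  join-least Z X⊆Z Y⊆Z a b a<b (inj₁ (b<a , _)) = contradiction a<b (ℕₚ.<-asym b<a)
  join-least Z X⊆Z Y⊆Z a b a<b (inj₂ (_ , b⇝⁺a)) = along b⇝⁺a
    where
    open TotalOrder Z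
    step : ∀ {c d} → c ⇝ d → c ≺ d
    step (d<c , inj₁ c≺d) = X⊆Z _ _ d<c c≺d
    step (d<c , inj₂ c≺d) = Y⊆Z _ _ d<c c≺d
    along : ∀ {c d} → c ⇝⁺ d → c ≺ d
    along [ c⇝d ]⁺       = step c⇝d
    along (c⇝e ∷ e⇝⁺d) = ≺-trans (step c⇝e) (along e⇝⁺d)

join-exists : (r : Fin n → ℕ) → Injective _≡_ _≡_ r → (σ τ : Perm n) → ∃ (IsJoinBy r σ τ)
join-exists r r-injective σ τ = J.perm , σ≤J , τ≤J , J-least
  where
  open JoinOrder r r-injective (Positions.order σ) (Positions.order τ)
  module J = Realisation join
  σ≤J : σ ≤[ r ] J.perm
  σ≤J a b a<b b◃a = from (J.realises b a) (join-inverts-X a b a<b (to (Positions.realises σ b a) b◃a))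
  τ≤J : τ ≤[ r ] J.perm
  τ≤J a b a<b b◃a = from (J.realises b a) (join-inverts-Y a b a<b (to (Positions.realises τ b a) b◃a))
  J-least : ∀ z → σ ≤[ r ] z → τ ≤[ r ] z → J.perm ≤[ r ] z
  J-least z σ≤z τ≤z a b a<b b◃a =
    from (Z.realises b a) (join-least Z.order σ⊆z τ⊆z a b a<b (to (J.realises b a) b◃a))
    where
    module Z = Positions z
    σ⊆z : ∀ a b → r a ℕ.< r b → TotalOrder._≺_ (Positions.order σ) b a → TotalOrder._≺_ Z.order b a
    σ⊆z a b a<b b≺a = to (Z.realises b a) (σ≤z a b a<b (from (Positions.realises σ b a) b≺a))
    τ⊆z : ∀ a b → r a ℕ.< r b → TotalOrder._≺_ (Positions.order τ) b a → TotalOrder._≺_ Z.order b a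
    τ⊆z a b a<b b≺a = to (Z.realises b a) (τ≤z a b a<b (from (Positions.realises τ b a) b≺a))

Reverses : (r s : Fin n → ℕ) → Set
Reverses {n} r s = ∀ {a b : Fin n} → r a ℕ.< r b → s b ℕ.< s a

≤-reverse : (r s : Fin n → ℕ) → Reverses s r → ∀ {σ τ} → σ ≤[ r ] τ → τ ≤[ s ] σ
≤-reverse r s s⇒r {σ} {τ} σ≤τ a b a<b b◃a with leftOf? σ b a
... | yes b◃a′ = b◃a′
... | no ¬b◃a = contradiction b◃a (leftOf-asym τ (σ≤τ b a (s⇒r a<b) a◃b))
  where
  a◃b : LeftOf σ a b
  a◃b = [ (λ b◃a′ → contradiction b◃a′ ¬b◃a) , id ] (leftOf-connex σ (λ b≡a → ℕₚ.<-irrefl (cong s (sym b≡a)) a<b))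

module _ (r s : Fin n → ℕ) (r⇒s : Reverses r s) (s⇒r : Reverses s r) {x y : Perm n} where

  join-reverse : ∀ {j} → IsJoinBy r x y j → IsMeetBy s x y j
  join-reverse {j} (x≤j , y≤j , least) =
    ≤-reverse r s s⇒r {x} {j} x≤j , ≤-reverse r s s⇒r {y} {j} y≤j ,
    λ z z≤x z≤y → ≤-reverse r s s⇒r {j} {z} (least z (≤-reverse s r r⇒s {z} {x} z≤x) (≤-reverse s r r⇒s {z} {y} z≤y))

  meet-reverse : ∀ {m} → IsMeetBy r x y m → IsJoinBy s x y m
  meet-reverse {m} (m≤x , m≤y , greatest) =
    ≤-reverse r s s⇒r {m} {x} m≤x , ≤-reverse r s s⇒r {m} {y} m≤y ,
    λ z x≤z y≤z → ≤-reverse r s s⇒r {z} {m} (greatest z (≤-reverse s r r⇒s {x} {z} x≤z) (≤-reverse s r r⇒s {y} {z} y≤z))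

Compatible : (Fin n → ℕ) → (Perm n → Perm n → Set) → Set
Compatible r R = (∀ x x′ y j j′ → R x x′ → IsJoinBy r x y j → IsJoinBy r x′ y j′ → R j j′)
               × (∀ x x′ y m m′ → R x x′ → IsMeetBy r x y m → IsMeetBy r x′ y m′ → R m m′)

compatible-reverse : {r s : Fin n → ℕ} → Reverses r s → Reverses s r → ∀ {R} → Compatible r R → Compatible s R
compatible-reverse {r = r} {s} r⇒s s⇒r (join-compat , meet-compat) =
  (λ x x′ y j j′ x≡x′ j-join j′-join → meet-compat x x′ y j j′ x≡x′
     (join-reverse s r s⇒r r⇒s {x} {y} {j} j-join) (join-reverse s r s⇒r r⇒s {x′} {y} {j′} j′-join)) ,
  (λ x x′ y m m′ x≡x′ m-meet m′-meet → join-compat x x′ y m m′ x≡x′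
     (meet-reverse s r s⇒r r⇒s {x} {y} {m} m-meet) (meet-reverse s r s⇒r r⇒s {x′} {y} {m′} m′-meet))

swap-congruent : (r : Fin n → ℕ) → Injective _≡_ _≡_ r →
                 ∀ {R : Perm n → Perm n → Set} → (∀ {x y} → R x y → R y x) → Compatible r R →
                 ∀ {π π′} → R π′ π → (o : TotalOrder n) → ∀ {p q} (p⋖q : Covers o p q) → r p ℕ.< r q →
                 Realisation.perm o ≤[ r ] π → LeftOf π p q → LeftOf π′ q p →
                 R (Realisation.perm o) (Realisation.perm (SwapCover.swapped o p⋖q))
swap-congruent {n} r r-injective {R} R-sym (join-compat , meet-compat) {π} {π′} π′≡π o {p} {q} p⋖q p<q ρ≤π p◃q q◃p =
  meet-compat π τ ρ′ ρ ρ′ (R-sym τ≡π) ρ-meet ρ′-meet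
  where
  open SwapCover o p⋖q
  ρ ρ′ : Perm n
  ρ  = O.perm
  ρ′ = O′.perm

  ≤-refl : ∀ σ → σ ≤[ r ] σ
  ≤-refl σ _ _ _ b◃a = b◃a

  τ : Perm n
  τ = proj₁ (join-exists r r-injective π′ π)
  τ-join : IsJoinBy r π′ π τ
  τ-join = proj₂ (join-exists r r-injective π′ π)

  τ≡π : R τ π
  τ≡π = join-compat π′ π π τ π π′≡π τ-join (≤-refl π , ≤-refl π , λ _ π≤z _ → π≤z)

  ρ≤ρ′ : ρ ≤[ r ] ρ′
  ρ≤ρ′ a b a<b b◃a with ≺⇒≺′ (to (O.realises b a) b◃a)
  ... | inj₁ b≺′a           = from (O′.realises b a) b≺′a
  ... | inj₂ (refl , refl) = contradiction a<b (ℕₚ.<-asym p<q)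

  ρ′≤τ : ρ′ ≤[ r ] τ
  ρ′≤τ a b a<b b◃a with ≺′⇒≺ (to (O′.realises b a) b◃a)
  ... | inj₁ b≺a           = proj₁ (proj₂ τ-join) a b a<b (ρ≤π a b a<b (from (O.realises b a) b≺a))
  ... | inj₂ (refl , refl) = proj₁ τ-join a b a<b q◃p

  ρ-meet : IsMeetBy r π ρ′ ρ
  ρ-meet = ρ≤π , ρ≤ρ′ , greatest
    where
    greatest : ∀ z → z ≤[ r ] π → z ≤[ r ] ρ′ → z ≤[ r ] ρ
    greatest z z≤π z≤ρ′ a b a<b b◃a with ≺′⇒≺ (to (O′.realises b a) (z≤ρ′ a b a<b b◃a))
    ... | inj₁ b≺a           = from (O.realises b a) b≺a
    ... | inj₂ (refl , refl) = contradiction (z≤π a b a<b b◃a) (leftOf-asym π p◃q)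

  ρ′-meet : IsMeetBy r τ ρ′ ρ′
  ρ′-meet = ρ′≤τ , ≤-refl ρ′ , λ _ _ z≤ρ′ → z≤ρ′

module Blocks (r : Fin n → ℕ) (r-injective : Injective _≡_ _≡_ r) (π : Perm n) {i j : Fin n} (i<j : i < j)
  (p<q : r (at π i) ℕ.< r (at π j))
  (gap : ∀ k → i < k → k < j → ¬ (r (at π i) ℕ.< r (at π k) × r (at π k) ℕ.< r (at π j))) where
  open Positions π

  p q : Fin n
  p = at π i
  q = at π j

  data Block (v : Fin n) : ℕ → Set where
    before : position v < i → Block v 0
    low    : i < position v → position v < j → r v ℕ.< r p → Block v 1
    first  : v ≡ p → Block v 2
    second : v ≡ q → Block v 3
    high   : i < position v → position v < j → r q ℕ.< r v → Block v 4
    after  : j < position v → Block v 5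

  position-p : position p ≡ i
  position-p = position-at i

  position-q : position q ≡ j
  position-q = position-at j

  at-position-≡ : ∀ {v k} → position v ≡ k → v ≡ at π k
  at-position-≡ {v} refl = sym (at-position v)

  middle-block : ∀ v → i < position v → position v < j → ∃ (Block v)
  middle-block v i<v v<j with ℕₚ.<-cmp (r v) (r p)
  ... | tri< v<p _ _ = 1 , low i<v v<j v<p
  ... | tri≈ _ v≡p _ = contradiction (trans (cong position (r-injective v≡p)) position-p) (Finₚ.<⇒≢ i<v ∘ sym)
  ... | tri> _ _ p<v with ℕₚ.<-cmp (r v) (r q)
  ...   | tri< v<q _ _ = contradiction (subst (λ w → r p ℕ.< r w × r w ℕ.< r q) (at-position-≡ refl) (p<v , v<q))
                                       (gap (position v) i<v v<j)
  ...   | tri≈ _ v≡q _ = contradiction (trans (cong position (r-injective v≡q)) position-q) (Finₚ.<⇒≢ v<j)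
  ...   | tri> _ _ q<v = 4 , high i<v v<j q<v

  block : ∀ v → ∃ (Block v)
  block v with Finₚ.<-cmp (position v) i
  ... | tri< v<i _ _ = 0 , before v<i
  ... | tri≈ _ v≡i _ = 2 , first (at-position-≡ v≡i)
  ... | tri> _ _ i<v with Finₚ.<-cmp (position v) j
  ...   | tri< v<j _ _ = middle-block v i<v v<j
  ...   | tri≈ _ v≡j _ = 3 , second (at-position-≡ v≡j)
  ...   | tri> _ _ j<v = 5 , after j<v

  key : Fin n → ℕ
  key v = proj₁ (block v)

  key-block : ∀ v → Block v (key v)
  key-block v = proj₂ (block v)

  block-p : ∀ {k} → Block p k → k ≡ 2
  block-p (before p<i)   = contradiction position-p (Finₚ.<⇒≢ p<i)
  block-p (low i<p _ _)  = contradiction (sym position-p) (Finₚ.<⇒≢ i<p)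
  block-p (first _)      = refl
  block-p (second p≡q)   = contradiction (at-injective p≡q) (Finₚ.<⇒≢ i<j)
  block-p (high i<p _ _) = contradiction (sym position-p) (Finₚ.<⇒≢ i<p)
  block-p (after j<p)    = contradiction (subst (j <_) position-p j<p) (Finₚ.<-asym i<j)

  block-q : ∀ {k} → Block q k → k ≡ 3
  block-q (before q<i)   = contradiction (subst (_< i) position-q q<i) (Finₚ.<-asym i<j)
  block-q (low _ q<j _)  = contradiction position-q (Finₚ.<⇒≢ q<j)
  block-q (first q≡p)    = contradiction (at-injective (sym q≡p)) (Finₚ.<⇒≢ i<j)
  block-q (second _)     = refl
  block-q (high _ q<j _) = contradiction position-q (Finₚ.<⇒≢ q<j)
  block-q (after j<q)    = contradiction (sym position-q) (Finₚ.<⇒≢ j<q)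

  position<i⇒block0 : ∀ {v k} → Block v k → position v < i → k ≡ 0
  position<i⇒block0 (before _)     _   = refl
  position<i⇒block0 (low i<v _ _)  v<i = contradiction i<v (Finₚ.<-asym v<i)
  position<i⇒block0 (first refl)   v<i = contradiction position-p (Finₚ.<⇒≢ v<i)
  position<i⇒block0 (second refl)  v<i = contradiction (subst (_< i) position-q v<i) (Finₚ.<-asym i<j)
  position<i⇒block0 (high i<v _ _) v<i = contradiction i<v (Finₚ.<-asym v<i)
  position<i⇒block0 (after j<v)    v<i = contradiction (Finₚ.<-trans j<v v<i) (Finₚ.<-asym i<j)

  block<2⇒position<i : ∀ {v k} → Block v k → k ℕ.< 2 → r p ℕ.< r v → position v < i
  block<2⇒position<i (before v<i)     _                  _   = v<i
  block<2⇒position<i (low _ _ v<p)    _                  p<v = contradiction p<v (ℕₚ.<-asym v<p)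
  block<2⇒position<i (first _)        (s≤s (s≤s ()))     _
  block<2⇒position<i (second _)       (s≤s (s≤s ()))     _
  block<2⇒position<i (high _ _ _)     (s≤s (s≤s ()))     _
  block<2⇒position<i (after _)        (s≤s (s≤s ()))     _

  -- Blocks are ordered as in π except for a low entry against p or a high entry, and q against
  -- a high entry; none of these pairs is a value-inversion.
  block-inversion : ∀ {a b k l} → Block a k → Block b l → r a ℕ.< r b → l ℕ.< k → position b < position a
  block-inversion (before _)     _              _   ()
  block-inversion (low i<a _ _)  (before b<i)   _   (s≤s z≤n)             = Finₚ.<-trans b<i i<a
  block-inversion (first refl)   (before b<i)   _   (s≤s z≤n)             = subst (_ <_) (sym position-p) b<i
  block-inversion (first refl)   (low _ _ b<p)  p<b (s≤s (s≤s z≤n))       = contradiction p<b (ℕₚ.<-asym b<p)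
  block-inversion (second refl)  (before b<i)   _   (s≤s z≤n)             = subst (_ <_) (sym position-q) (Finₚ.<-trans b<i i<j)
  block-inversion (second refl)  (low _ b<j _)  _   (s≤s (s≤s z≤n))       = subst (_ <_) (sym position-q) b<j
  block-inversion (second refl)  (first refl)   _   (s≤s (s≤s (s≤s z≤n))) = subst₂ _<_ (sym position-p) (sym position-q) i<j
  block-inversion (high i<a _ _) (before b<i)   _   (s≤s z≤n)             = Finₚ.<-trans b<i i<a
  block-inversion (high _ _ q<a) (low _ _ b<p)  a<b (s≤s (s≤s z≤n))       =
    contradiction (ℕₚ.<-trans q<a (ℕₚ.<-trans a<b b<p)) (ℕₚ.<-asym p<q)
  block-inversion (high i<a _ _) (first refl)   _   (s≤s (s≤s (s≤s z≤n))) = subst (_< _) (sym position-p) i<a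
  block-inversion (high _ _ q<a) (second refl)  a<q (s≤s (s≤s (s≤s (s≤s z≤n)))) = contradiction a<q (ℕₚ.<-asym q<a)
  block-inversion (after j<a)    (before b<i)   _   (s≤s z≤n)             = Finₚ.<-trans b<i (Finₚ.<-trans i<j j<a)
  block-inversion (after j<a)    (low _ b<j _)  _   (s≤s (s≤s z≤n))       = Finₚ.<-trans b<j j<a
  block-inversion (after j<a)    (first refl)   _   (s≤s (s≤s (s≤s z≤n))) = subst (_< _) (sym position-p) (Finₚ.<-trans i<j j<a)
  block-inversion (after j<a)    (second refl)  _   (s≤s (s≤s (s≤s (s≤s z≤n)))) = subst (_< _) (sym position-q) j<a
  block-inversion (after j<a)    (high _ b<j _) _   (s≤s (s≤s (s≤s (s≤s (s≤s z≤n))))) = Finₚ.<-trans b<j j<a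

  key-p : key p ≡ 2
  key-p = block-p (key-block p)

  key-q : key q ≡ 3
  key-q = block-q (key-block q)

  key≡2 : ∀ {v} → key v ≡ 2 → v ≡ p
  key≡2 {v} eq with subst (Block v) eq (key-block v)
  ... | first v≡p = v≡p

  key≡3 : ∀ {v} → key v ≡ 3 → v ≡ q
  key≡3 {v} eq with subst (Block v) eq (key-block v)
  ... | second v≡q = v≡q

  ρ-order : TotalOrder n
  ρ-order = lexOrder key

  open TotalOrder ρ-order using () renaming (_≺_ to _≺ρ_)

  p⋖q : Covers ρ-order p q
  p⋖q = inj₁ (subst₂ ℕ._<_ (sym key-p) (sym key-q) (ℕₚ.n<1+n 2)) , λ p≺v v≺q → ℕₚ.<⇒≱ (below-q v≺q) (above-p p≺v)
    where
    above-p : ∀ {v} → p ≺ρ v → 2 ℕ.< key v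
    above-p {v} p≺v = subst (ℕ._< key v) key-p (lex-key< key (λ eq → sym (key≡2 (trans (sym eq) key-p))) p≺v)
    below-q : ∀ {v} → v ≺ρ q → key v ℕ.< 3
    below-q {v} v≺q = subst (key v ℕ.<_) key-q (lex-key< key (λ eq → key≡3 (trans eq key-q)) v≺q)

  ≺ρp⇔position<i : ∀ {c} → r p ℕ.< r c → c ≺ρ p ⇔ position c < i
  ≺ρp⇔position<i {c} p<c = mk⇔
    (λ c≺p → block<2⇒position<i (key-block c)
               (subst (key c ℕ.<_) key-p (lex-key< key (λ eq → key≡2 (trans eq key-p)) c≺p)) p<c)
    (λ c<i → inj₁ (subst₂ ℕ._<_ (sym (position<i⇒block0 (key-block c) c<i)) (sym key-p) (s≤s z≤n)))

  ρ≤π : Realisation.perm ρ-order ≤[ r ] π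
  ρ≤π a b a<b b◃a = from (realises b a) (block-order (to (Realisation.realises ρ-order b a) b◃a))
    where
    block-order : b ≺ρ a → position b < position a
    block-order (inj₁ b<a)     = block-inversion (key-block a) (key-block b) a<b b<a
    block-order (inj₂ (_ , b<a)) = b<a

  left-of-p⇔ : ∀ {c} → r p ℕ.< r c → LeftOf (Realisation.perm ρ-order) c p ⇔ (∃[ k ] (k < i × at π k ≡ c))
  left-of-p⇔ {c} p<c = mk⇔
    (λ c◃p → position c , to (≺ρp⇔position<i p<c) (to (Realisation.realises ρ-order c p) c◃p) , at-position c)
    (λ (k , k<i , k↦c) → from (Realisation.realises ρ-order c p)
       (from (≺ρp⇔position<i p<c) (subst (_< i) (sym (trans (cong position (sym k↦c)) (position-at k))) k<i)))

adjSwap-unique : ∀ {σ σ′ : Perm n} {x y x′ y′} → AdjSwap σ σ′ x y → AdjSwap σ σ′ x′ y′ → x′ ≡ x × y′ ≡ y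
adjSwap-unique {n} {σ} {σ′} (k , k′ , k′≡1+k , σk , σk′ , _ , _ , unmoved) (t , t′ , t′≡1+t , σt , σt′ , σ′t , σ′t′ , _) =
  trans (sym σt) (trans (cong (at σ) t≡k) σk) , trans (sym σt′) (trans (cong (at σ) t′≡k′) σk′)
  where
  open Positions σ using (at-injective)
  t≢t′ : t ≢ t′
  t≢t′ t≡t′ = ℕₚ.1+n≢n (sym (trans (cong toℕ t≡t′) t′≡1+t))
  moved : ∀ u → at σ u ≢ at σ′ u → u ≡ k ⊎ u ≡ k′
  moved u σu≢σ′u with u Finₚ.≟ k | u Finₚ.≟ k′
  ... | yes u≡k | _        = inj₁ u≡k
  ... | no _    | yes u≡k′ = inj₂ u≡k′
  ... | no u≢k  | no u≢k′  = contradiction (unmoved u u≢k u≢k′) σu≢σ′u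
  t-moved : at σ t ≢ at σ′ t
  t-moved eq = t≢t′ (at-injective (trans eq (trans σ′t (sym σt′))))
  t′-moved : at σ t′ ≢ at σ′ t′
  t′-moved eq = t≢t′ (at-injective (trans (trans σt (sym σ′t′)) (sym eq)))
  t′≤k′ : toℕ t′ ℕ.≤ toℕ k′
  t′≤k′ with moved t′ t′-moved
  ... | inj₁ refl = subst (toℕ t′ ℕ.≤_) (sym k′≡1+k) (ℕₚ.n≤1+n (toℕ t′))
  ... | inj₂ refl = ℕₚ.≤-refl
  t≡k : t ≡ k
  t≡k with moved t t-moved
  ... | inj₁ t≡k  = t≡k
  ... | inj₂ refl = contradiction (subst (ℕ._≤ toℕ t) t′≡1+t t′≤k′) (ℕₚ.n≮n (toℕ t))
  t′≡k′ : t′ ≡ k′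
  t′≡k′ = Finₚ.toℕ-injective (trans t′≡1+t (trans (cong (suc ∘ toℕ) t≡k) (sym k′≡1+k)))

minF-maxF : ∀ {a b x y : Fin n} → a < b → (x ≡ a × y ≡ b) ⊎ (x ≡ b × y ≡ a) → minF x y ≡ a × maxF x y ≡ b
minF-maxF {a = a} {b} a<b (inj₁ (refl , refl)) with toℕ a ℕ.≤ᵇ toℕ b | ℕₚ.≤⇒≤ᵇ (ℕₚ.<⇒≤ a<b)
... | true | _ = refl , refl
minF-maxF {a = a} {b} a<b (inj₂ (refl , refl)) with toℕ b ℕ.≤ᵇ toℕ a | ℕₚ.≤ᵇ⇒≤ (toℕ b) (toℕ a)
... | true  | b≤a = contradiction (b≤a _) (ℕₚ.<⇒≱ a<b)
... | false | _   = refl , refl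

fence-of-edge : ∀ {R F} → IsFenceSetOf R F → ∀ {σ σ′ : Perm n} {x y} → R σ σ′ → AdjSwap σ σ′ x y →
                (L : Subset n) → (∀ c → c ∈ L ⇔ (Between (minF x y) (maxF x y) c × LeftOf σ c x)) →
                F (minF x y) (maxF x y) L
fence-of-edge {n} {F = F} fences {σ} {σ′} {x} {y} σ≡σ′ x⇄y L L-spec
  with to (fences σ σ′ (x , y , x⇄y)) σ≡σ′
... | a , b , L′ , F-abL′ , a<b , L′⊆]a,b[ , a⇄b , sides =
  subst₂ (λ m M → F m M L) (sym m≡a) (sym M≡b) (subst (F a b) (⊆-antisym L′⊆L L⊆L′) F-abL′)
  where
  endpoints : (x ≡ a × y ≡ b) ⊎ (x ≡ b × y ≡ a)
  endpoints = Data.Sum.map (Data.Product.map sym sym ∘ adjSwap-unique {σ = σ} {σ′} x⇄y)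
                           (Data.Product.map sym sym ∘ adjSwap-unique {σ = σ} {σ′} x⇄y) a⇄b

  m≡a : minF x y ≡ a
  m≡a = proj₁ (minF-maxF a<b endpoints)
  M≡b : maxF x y ≡ b
  M≡b = proj₂ (minF-maxF a<b endpoints)

  between : ∀ {c} → Between a b c → Between (minF x y) (maxF x y) c
  between {c} = subst₂ (λ m M → Between m M c) (sym m≡a) (sym M≡b)

  at-x : ∀ {P : Fin n → Set} → P a × P b → P x
  at-x {P} (Pa , Pb) = [ (λ (x≡a , _) → subst P (sym x≡a) Pa) , (λ (x≡b , _) → subst P (sym x≡b) Pb) ]′ endpoints

  L′⊆L : ∀ {c} → c ∈ L′ → c ∈ L
  L′⊆L {c} c∈L′ = from (L-spec c) (between (L′⊆]a,b[ c c∈L′) , at-x (proj₁ (sides c (L′⊆]a,b[ c c∈L′)) c∈L′))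

  L⊆L′ : ∀ {c} → c ∈ L → c ∈ L′
  L⊆L′ {c} c∈L with to (L-spec c) c∈L | c ∈? L′
  ... | _             | yes c∈L′ = c∈L′
  ... | btw , c◃x | no c∉L′  =
    contradiction c◃x (leftOf-asym σ (at-x (proj₂ (sides c (subst₂ (λ m M → Between m M c) m≡a M≡b btw)) c∉L′)))

opposite-rank : Fin n → ℕ
opposite-rank v = toℕ (Fin.opposite v)

toℕ-reverses-opposite : Reverses {n} toℕ opposite-rank
toℕ-reverses-opposite {a = a} {b} a<b =
  subst₂ ℕ._<_ (sym (Finₚ.opposite-prop b)) (sym (Finₚ.opposite-prop a)) (ℕₚ.∸-monoʳ-< (s≤s a<b) (Finₚ.toℕ<n b))

opposite-reverses-toℕ : Reverses {n} opposite-rank toℕ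
opposite-reverses-toℕ {a = a} {b} a<b with ℕₚ.<-cmp (toℕ b) (toℕ a)
... | tri< b<a _ _ = b<a
... | tri≈ _ b≡a _ = contradiction (subst (λ c → opposite-rank c ℕ.< opposite-rank b) (sym (Finₚ.toℕ-injective b≡a)) a<b) (ℕₚ.<-irrefl refl)
... | tri> _ _ a<b′ = contradiction (toℕ-reverses-opposite a<b′) (ℕₚ.<-asym a<b)

opposite-rank-injective : Injective _≡_ _≡_ (opposite-rank {n})
opposite-rank-injective {x = a} {y = b} eq =
  trans (sym (Finₚ.opposite-involutive a)) (trans (cong Fin.opposite (Finₚ.toℕ-injective eq)) (Finₚ.opposite-involutive b))

record Orientation (p q : Fin n) : Set₁ where
  field
    rank           : Fin n → ℕ
    rank-injective : Injective _≡_ _≡_ rank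
    p<q            : rank p ℕ.< rank q
    between⇔       : ∀ c → Between (minF p q) (maxF p q) c ⇔ (rank p ℕ.< rank c × rank c ℕ.< rank q)
    compatible     : ∀ {R} → IsLatticeCongruence R → Compatible rank R

orientation : ∀ {p q : Fin n} → p ≢ q → Orientation p q
orientation {n} {p} {q} p≢q with ℕₚ.<-cmp (toℕ p) (toℕ q)
... | tri≈ _ p≡q _ = contradiction (Finₚ.toℕ-injective p≡q) p≢q
... | tri< p<q _ _ = record
  { rank           = toℕ
  ; rank-injective = Finₚ.toℕ-injective
  ; p<q            = p<q
  ; between⇔       = λ c → mk⇔ (subst₂ (λ m M → Between m M c) m≡p M≡q) (subst₂ (λ m M → Between m M c) (sym m≡p) (sym M≡q))
  ; compatible     = λ LC → IsLatticeCongruence.join-compat LC , IsLatticeCongruence.meet-compat LC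
  }
  where
  m≡p : minF p q ≡ p
  m≡p = proj₁ (minF-maxF p<q (inj₁ (refl , refl)))
  M≡q : maxF p q ≡ q
  M≡q = proj₂ (minF-maxF p<q (inj₁ (refl , refl)))
... | tri> _ _ q<p = record
  { rank           = opposite-rank
  ; rank-injective = opposite-rank-injective
  ; p<q            = toℕ-reverses-opposite q<p
  ; between⇔       = λ c → mk⇔
      (λ btw → let (q<c , c<p) = subst₂ (λ m M → Between m M c) m≡q M≡p btw in
               toℕ-reverses-opposite c<p , toℕ-reverses-opposite q<c)
      (λ (p<c , c<q) → subst₂ (λ m M → Between m M c) (sym m≡q) (sym M≡p)
               (opposite-reverses-toℕ c<q , opposite-reverses-toℕ p<c))
  ; compatible     = λ LC → compatible-reverse toℕ-reverses-opposite opposite-reverses-toℕ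
                              (IsLatticeCongruence.join-compat LC , IsLatticeCongruence.meet-compat LC)
  }
  where
  m≡q : minF p q ≡ q
  m≡q = proj₁ (minF-maxF q<p (inj₂ (refl , refl)))
  M≡p : maxF p q ≡ p
  M≡p = proj₂ (minF-maxF q<p (inj₂ (refl , refl)))

lemma21 : (n : ℕ) (R : Perm n → Perm n → Set) → IsLatticeCongruence R
    → (F : Fin n → Fin n → Subset n → Set) → IsFenceSetOf R F
    → (π : Perm n) (i j : Fin n) → i < j
    → (∀ k → i < k → k < j → ¬ Between (minF (at π i) (at π j)) (maxF (at π i) (at π j)) (at π k))
    → (∃[ π' ] (R π' π × LeftOf π' (at π j) (at π i)))
    → (L : Subset n)
    → (∀ c → c ∈ L ⇔ (Between (minF (at π i) (at π j)) (maxF (at π i) (at π j)) c × ∃[ k ] (k < i × at π k ≡ c)))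
    → F (minF (at π i) (at π j)) (maxF (at π i) (at π j)) L
lemma21 n R LC F fences π i j i<j gap (π′ , π′≡π , q◃p) L L-spec =
  fence-of-edge fences ρ≡ρ′ (SwapCover.adjacent ρ-order p⋖q) L L-spec′
  where
  p≢q : at π i ≢ at π j
  p≢q p≡q = Finₚ.<⇒≢ i<j (Positions.at-injective π p≡q)
  open Orientation (orientation p≢q)
  open Blocks rank rank-injective π i<j p<q (λ k i<k k<j → gap k i<k k<j ∘ from (between⇔ (at π k)))

  ρ≡ρ′ : R (Realisation.perm ρ-order) (Realisation.perm (SwapCover.swapped ρ-order p⋖q))
  ρ≡ρ′ = swap-congruent rank rank-injective (IsEquivalence.sym (IsLatticeCongruence.isEquivalence LC))
           (compatible LC) π′≡π ρ-order p⋖q p<q ρ≤π (i , j , i<j , refl , refl) q◃p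

  L-spec′ : ∀ c → c ∈ L ⇔ (Between (minF p q) (maxF p q) c × LeftOf (Realisation.perm ρ-order) c p)
  L-spec′ c = mk⇔
    (λ c∈L → let (btw , c-early) = to (L-spec c) c∈L in btw , from (left-of-p⇔ (proj₁ (to (between⇔ c) btw))) c-early)
    (λ (btw , c◃p) → from (L-spec c) (btw , to (left-of-p⇔ (proj₁ (to (between⇔ c) btw))) c◃p))
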